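{- Consider the dynamic algorithm and counters described in the context, run on any sequence of $T$ hyperedge insertions/deletions starting from the empty hypergraph. Then at all times $C^{down}\le I^{down}$.
   Context: Setting: hypergraph $\mathcal{G}=(V,E)$ on a fixed node set with $|V|=n$, every hyperedge containing at most $f$ nodes, initially $E=\emptyset$, subject to a sequence of $T$ hyperedge insertions/deletions. Parameters: $\beta=17$, $\alpha=1+36f^2\beta^2$, $L=\lceil f\log_\beta n\rceil+1$. Each node $v$ has a level $\ell(v)\in\{0,\ldots,L\}$, initially $0$. For a hyperedge $e$, $\ell(e)=\max_{v\in e}\ell(v)$ and $w(e)=\beta^{ -\ell(e)}$; $W_v=\sum_{e\ni v}w(e)$. For $v\in e$, $\ell_v(e)=\max_{u\in e,u\neq v}\ell(u)$, and $W_{v\to i}=\sum_{e\ni v}\beta^{ -\max(\ell_v(e),i)}$ (the value $W_v$ would take if $v$ moved to level $i$ with other levels unchanged). A node is Down-Dirty if $\ell(v)>0$ and $W_v\le 1/(\alpha\beta^2)$; it is Up-Dirty if either $\ell(v)=0$ and $W_v>1/\beta^2$, or $\ell(v)>0$ and $W_v\ge 1$. Algorithm: after each update, while some node is Down-Dirty or Up-Dirty: if some Up-Dirty node $v$ exists, with $i=\ell(v)$ move $v$ to the smallest level $j\in\{i+1,\ldots,L\}$ with $W_{v\to j}\le 1/\beta$ (an up-jump); otherwise pick a Down-Dirty node $v$, with $i=\ell(v)$ move $v$ to the largest level $j\in\{1,\ldots,i-1\}$ with $W_{v\to j}>1/\beta^2$, or to level $0$ if no such $j$ exists (a down-jump).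 Counters, all initially $0$: at each up-jump of $v$ from level $i$ to level $j$, $C^{up}$ increases by the number of hyperedges $e\ni v$ with $\ell_v(e)\le j-1$; at each down-jump of $v$ from level $i$, $C^{down}$ increases by the number of hyperedges $e\ni v$ with $\ell_v(e)\le i$, and $I^{down}$ increases by $\beta^{i-2}/\alpha$. -}

module Defs where

open import Data.Nat as ℕ using (ℕ; zero; suc; _^_; _∸_; _⊔_)
open import Data.Nat.Properties using (m^n≢0)
open import Data.Integer using (+_)
open import Data.Rational as ℚ using (ℚ; 0ℚ; 1ℚ; _/_)
open import Data.Fin using (Fin)
open import Data.Fin.Subset using (Subset; _∈_; _∉_; ∣_∣)
open import Data.Fin.Subset.Properties using (_∈?_)
open import Data.Fin.Properties using () renaming (_≟_ to _≟ᶠ_)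
open import Data.List as List using (List; []; _∷_; _++_; allFin; filter)
open import Data.List.Membership.Propositional as LM using ()
open import Data.Product using (Σ; _×_; _,_; ∃; ∃-syntax)
open import Data.Sum using (_⊎_)
open import Relation.Nullary using (¬_; yes; no)
open import Relation.Nullary.Decidable using (⌊_⌋)
open import Relation.Binary.PropositionalEquality using (_≡_)

β : ℕ
β = 17

α : ℕ → ℕ
α f = 1 ℕ.+ 36 ℕ.* (f ℕ.* f) ℕ.* (β ℕ.* β)

β⁻ : ℕ → ℚ
β⁻ k = _/_ (+ 1) (β ^ k) {{m^n≢0 β k}}

1/αβ² : ℕ → ℚ
1/αβ² f = _/_ (+ 1) (α f ℕ.* (β ℕ.* β)) {{ℕ.>-nonZero (ℕ.s≤s ℕ.z≤n)}}

-- β^{i-2}/α  (i an integer level, written as β^i / (α β²) to stay in ℕ exponents)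
incI : ℕ → ℕ → ℚ
incI f i = _/_ (+ (β ^ i)) (α f ℕ.* (β ℕ.* β)) {{ℕ.>-nonZero (ℕ.s≤s ℕ.z≤n)}}

-- A hyperedge is a subset of the node set Fin n; the hyperedge set E is a
-- duplicate-free list of hyperedges (order irrelevant).
Edge : ℕ → Set
Edge n = Subset n

Levels : ℕ → Set
Levels n = Fin n → ℕ

maxL : List ℕ → ℕ
maxL = List.foldr _⊔_ 0

lvlE : ∀ {n} → Levels n → Edge n → ℕ
lvlE {n} ℓ e = maxL (List.map ℓ (filter (λ u → u ∈? e) (allFin n)))

lvlEv : ∀ {n} → Levels n → Fin n → Edge n → ℕ
lvlEv {n} ℓ v e =
  maxL (List.map ℓ (filter (λ u → u ∈? e) (filter (λ u → Relation.Nullary.¬? (u ≟ᶠ v)) (allFin n))))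
  where import Relation.Nullary

incident : ∀ {n} → List (Edge n) → Fin n → List (Edge n)
incident E v = filter (λ e → v ∈? e) E

sumℚ : List ℚ → ℚ
sumℚ = List.foldr ℚ._+_ 0ℚ

W : ∀ {n} → List (Edge n) → Levels n → Fin n → ℚ
W E ℓ v = sumℚ (List.map (λ e → β⁻ (lvlE ℓ e)) (incident E v))

Wto : ∀ {n} → List (Edge n) → Levels n → Fin n → ℕ → ℚ
Wto E ℓ v i = sumℚ (List.map (λ e → β⁻ (lvlEv ℓ v e ⊔ i)) (incident E v))

countLe : ∀ {n} → List (Edge n) → Levels n → Fin n → ℕ → ℕ
countLe E ℓ v k = List.length (filter (λ e → lvlEv ℓ v e ℕ.≤? k) (incident E v))

DownDirty : ∀ {n} → ℕ → List (Edge n) → Levels n → Fin n → Set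
DownDirty f E ℓ v = (0 ℕ.< ℓ v) × (W E ℓ v ℚ.≤ 1/αβ² f)

UpDirty : ∀ {n} → List (Edge n) → Levels n → Fin n → Set
UpDirty E ℓ v =
  ((ℓ v ≡ 0) × (β⁻ 2 ℚ.< W E ℓ v)) ⊎ ((0 ℕ.< ℓ v) × (1ℚ ℚ.≤ W E ℓ v))

setLevel : ∀ {n} → Levels n → Fin n → ℕ → Levels n
setLevel ℓ v j u with u ≟ᶠ v
... | yes _ = j
... | no  _ = ℓ u

record State (n : ℕ) : Set where
  constructor st
  field
    edges : List (Edge n)
    level : Levels n
    Cup   : ℕ
    Cdown : ℕ
    Idown : ℚ
open State public

initial : ∀ n → State n
initial n = st [] (λ _ → 0) 0 0 0ℚ

-- a node set with no dirty node (the while loop has terminated)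
Clean : ∀ {n} → ℕ → State n → Set
Clean f s = ∀ v → ¬ UpDirty (edges s) (level s) v × ¬ DownDirty f (edges s) (level s) v

-- States reachable by the algorithm with parameters f and L (any choice of
-- dirty node at each step, any valid sequence of updates of any length T).
data Reachable {n : ℕ} (f L : ℕ) : State n → Set where
  init : Reachable f L (initial n)
  insert : ∀ {E ℓ cu cd id} (e : Edge n) →
    Reachable f L (st E ℓ cu cd id) → Clean f (st E ℓ cu cd id) →
    ∣ e ∣ ℕ.≤ f → ¬ (e LM.∈ E) →
    Reachable f L (st (e ∷ E) ℓ cu cd id)
  delete : ∀ {E₁ E₂ ℓ cu cd id} (e : Edge n) →
    Reachable f L (st (E₁ ++ e ∷ E₂) ℓ cu cd id) →
    Clean f (st (E₁ ++ e ∷ E₂) ℓ cu cd id) →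
    Reachable f L (st (E₁ ++ E₂) ℓ cu cd id)
  up-jump : ∀ {E ℓ cu cd id} (v : Fin n) (j : ℕ) →
    Reachable f L (st E ℓ cu cd id) →
    UpDirty E ℓ v →
    ℓ v ℕ.< j → j ℕ.≤ L →
    Wto E ℓ v j ℚ.≤ β⁻ 1 →
    (∀ k → ℓ v ℕ.< k → k ℕ.< j → ¬ (Wto E ℓ v k ℚ.≤ β⁻ 1)) →
    Reachable f L (st E (setLevel ℓ v j) (cu ℕ.+ countLe E ℓ v (j ∸ 1)) cd id)
  down-jump : ∀ {E ℓ cu cd id} (v : Fin n) (j : ℕ) →
    Reachable f L (st E ℓ cu cd id) →
    (∀ u → ¬ UpDirty E ℓ u) →
    DownDirty f E ℓ v →
    ( ((1 ℕ.≤ j) × (j ℕ.< ℓ v) × (β⁻ 2 ℚ.< Wto E ℓ v j)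
        × (∀ k → j ℕ.< k → k ℕ.< ℓ v → ¬ (β⁻ 2 ℚ.< Wto E ℓ v k)))
    ⊎ ((j ≡ 0) × (∀ k → 1 ℕ.≤ k → k ℕ.< ℓ v → ¬ (β⁻ 2 ℚ.< Wto E ℓ v k))) ) →
    Reachable f L (st E (setLevel ℓ v j) cu
                      (cd ℕ.+ countLe E ℓ v (ℓ v))
                      (id ℚ.+ incI f (ℓ v)))

-- L = ⌈f log_β n⌉ + 1, characterised for n ≥ 1 by: L = k + 1 where k is the
-- least natural number with n^f ≤ β^k.
IsL : ℕ → ℕ → ℕ → Set
IsL n f L = Σ ℕ λ k → (L ≡ suc k) × (n ^ f ℕ.≤ β ^ k) × (∀ m → n ^ f ℕ.≤ β ^ m → k ℕ.≤ m)

-- At a down-jump of v from level i, every hyperedge e ∋ v with ℓ_v(e) ≤ i has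
-- ℓ(e) = i and hence weight β^{-i}. Counting only these terms, their number c
-- satisfies c β^{-i} ≤ W_v ≤ 1/(αβ²), i.e. c ≤ β^{i-2}/α: each down-jump adds
-- to C^down at most what it adds to I^down, and no other step touches either.
module Submission where

open import Defs
open import Data.Nat using (ℕ; _≤_)
open import Data.Integer using (+_)
open import Data.Rational as ℚ using (ℚ; _/_)

open import Algebra.Definitions.RawMonoid ℚ.+-0-rawMonoid using (_×_)
open import Data.Fin.Properties using () renaming (_≟_ to _≟ᶠ_)
open import Data.Fin.Subset.Properties using (_∈?_)
import Data.Integer as ℤ
import Data.Integer.Properties as ℤ
open import Data.Integer.Tactic.RingSolver using (solve-∀)
open import Data.List as List using (List; []; _∷_; filter; allFin)
open import Data.List.Membership.Propositional using (_∈_)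
open import Data.List.Membership.Propositional.Properties
  using (∈-filter⁺; ∈-filter⁻; ∈-map⁺; ∈-map⁻; ∈-allFin)
open import Data.List.Relation.Unary.Any using (here; there)
open import Data.Nat as ℕ using (suc)
import Data.Nat.Properties as ℕ
open import Data.Product using (_,_; proj₂)
import Data.Rational.Properties as ℚ
open import Data.Rational.Unnormalised as ℚᵘ using (mkℚᵘ; *≤*; *≡*)
import Data.Rational.Unnormalised.Properties as ℚᵘ
open import Relation.Nullary using (yes; no; ¬?)
open import Relation.Unary using (Decidable)
open import Function using (case_of_)
open import Relation.Binary.PropositionalEquality

toℚᵘ-/ : ∀ (p : ℤ.ℤ) d → ℚ.toℚᵘ (p / suc d) ℚᵘ.≃ mkℚᵘ p d
toℚᵘ-/ p d = ℚ.toℚᵘ-fromℚᵘ (mkℚᵘ p d)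

*≤*⇒/≤/ : ∀ (p q : ℤ.ℤ) b d → p ℤ.* + suc d ℤ.≤ q ℤ.* + suc b →
          p / suc b ℚ.≤ q / suc d
*≤*⇒/≤/ p q b d h = ℚ.toℚᵘ-cancel-≤
  (ℚᵘ.≤-respˡ-≃ (ℚᵘ.≃-sym (toℚᵘ-/ p b)) (ℚᵘ.≤-respʳ-≃ (ℚᵘ.≃-sym (toℚᵘ-/ q d)) (*≤* h)))

/≤/⇒*≤* : ∀ (p q : ℤ.ℤ) b d → p / suc b ℚ.≤ q / suc d →
          p ℤ.* + suc d ℤ.≤ q ℤ.* + suc b
/≤/⇒*≤* p q b d h
  with ℚᵘ.≤-respˡ-≃ (toℚᵘ-/ p b) (ℚᵘ.≤-respʳ-≃ (toℚᵘ-/ q d) (ℚ.toℚᵘ-mono-≤ h))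
... | *≤* k = k

+-/ : ∀ (p q : ℤ.ℤ) d → p / suc d ℚ.+ q / suc d ≡ (p ℤ.+ q) / suc d
+-/ p q d = ℚ.toℚᵘ-injective (begin-equality
    ℚ.toℚᵘ (p / suc d ℚ.+ q / suc d)         ≃⟨ ℚ.toℚᵘ-homo-+ (p / suc d) (q / suc d) ⟩
    ℚ.toℚᵘ (p / suc d) ℚᵘ.+ ℚ.toℚᵘ (q / suc d) ≃⟨ ℚᵘ.+-cong (toℚᵘ-/ p d) (toℚᵘ-/ q d) ⟩
    mkℚᵘ p d ℚᵘ.+ mkℚᵘ q d                   ≃⟨ *≡* cross-multiplied ⟩
    mkℚᵘ (p ℤ.+ q) d                         ≃⟨ ℚᵘ.≃-sym (toℚᵘ-/ (p ℤ.+ q) d) ⟩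
    ℚ.toℚᵘ ((p ℤ.+ q) / suc d)               ∎)
  where
  open ℚᵘ.≤-Reasoning
  D = + suc d
  distrib : ∀ x y z → (x ℤ.* z ℤ.+ y ℤ.* z) ℤ.* z ≡ (x ℤ.+ y) ℤ.* (z ℤ.* z)
  distrib = solve-∀
  cross-multiplied : (p ℤ.* D ℤ.+ q ℤ.* D) ℤ.* D ≡ (p ℤ.+ q) ℤ.* + (suc d ℕ.* suc d)
  cross-multiplied = trans (distrib p q D) (cong ((p ℤ.+ q) ℤ.*_) (sym (ℤ.pos-* (suc d) (suc d))))

×-1/ : ∀ c d → c × ((+ 1) / suc d) ≡ (+ c) / suc d
×-1/ ℕ.zero d = ℚ.toℚᵘ-injective (ℚᵘ.≃-sym (ℚᵘ.≃-trans (toℚᵘ-/ (+ 0) d) (*≡* refl)))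
×-1/ (suc c) d = trans (cong ((+ 1 / suc d) ℚ.+_) (×-1/ c d)) (+-/ (+ 1) (+ c) d)

1/-nonNeg : ∀ b .{{_ : ℕ.NonZero b}} → ℚ.0ℚ ℚ.≤ (+ 1) / b
1/-nonNeg (suc b) = ℚ.toℚᵘ-cancel-≤
  (ℚᵘ.≤-respʳ-≃ (ℚᵘ.≃-sym (toℚᵘ-/ (+ 1) b)) (*≤* (ℤ.+≤+ ℕ.z≤n)))

1/-antimono-≤ : ∀ a b .{{_ : ℕ.NonZero a}} .{{_ : ℕ.NonZero b}} →
                a ≤ b → (+ 1) / b ℚ.≤ (+ 1) / a
1/-antimono-≤ (suc a) (suc b) a≤b = *≤*⇒/≤/ (+ 1) (+ 1) b a
  (subst₂ ℤ._≤_ (sym (ℤ.*-identityˡ _)) (sym (ℤ.*-identityˡ _)) (ℤ.+≤+ a≤b))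

×-1/≤1/⇒≤/ : ∀ c b d .{{_ : ℕ.NonZero b}} .{{_ : ℕ.NonZero d}} →
             c × ((+ 1) / b) ℚ.≤ (+ 1) / d → (+ c) / 1 ℚ.≤ (+ b) / d
×-1/≤1/⇒≤/ c (suc b) (suc d) h = *≤*⇒/≤/ (+ c) (+ suc b) 0 d
  (subst (+ c ℤ.* + suc d ℤ.≤_) (trans (ℤ.*-identityˡ (+ suc b)) (sym (ℤ.*-identityʳ (+ suc b))))
    (/≤/⇒*≤* (+ c) (+ 1) b d (subst (ℚ._≤ _) (×-1/ c b) h)))

β⁻-antimono-≤ : ∀ {i j} → i ≤ j → β⁻ j ℚ.≤ β⁻ i
β⁻-antimono-≤ {i} {j} i≤j =
  1/-antimono-≤ (β ℕ.^ i) (β ℕ.^ j) {{ℕ.m^n≢0 β i}} {{ℕ.m^n≢0 β j}} (ℕ.^-monoʳ-≤ β i≤j)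

β⁻-nonNeg : ∀ i → ℚ.0ℚ ℚ.≤ β⁻ i
β⁻-nonNeg i = 1/-nonNeg (β ℕ.^ i) {{ℕ.m^n≢0 β i}}

length-filter-×≤sum : ∀ {X : Set} {P : X → Set} (P? : Decidable P) (g : X → ℚ) (b : ℚ) →
  (∀ x → ℚ.0ℚ ℚ.≤ g x) → (∀ x → P x → b ℚ.≤ g x) →
  ∀ xs → List.length (filter P? xs) × b ℚ.≤ sumℚ (List.map g xs)
length-filter-×≤sum P? g b g≥0 P⇒b≤g [] = ℚ.≤-refl
length-filter-×≤sum P? g b g≥0 P⇒b≤g (x ∷ xs) with P? x
... | yes Px = ℚ.+-mono-≤ (P⇒b≤g x Px) (length-filter-×≤sum P? g b g≥0 P⇒b≤g xs)
... | no  _  = subst (ℚ._≤ _) (ℚ.+-identityˡ _)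
                 (ℚ.+-mono-≤ (g≥0 x) (length-filter-×≤sum P? g b g≥0 P⇒b≤g xs))

maxL-upper : ∀ {x} xs → x ∈ xs → x ≤ maxL xs
maxL-upper (y ∷ ys) (here refl) = ℕ.m≤m⊔n y (maxL ys)
maxL-upper (y ∷ ys) (there x∈ys) = ℕ.≤-trans (maxL-upper ys x∈ys) (ℕ.m≤n⊔m y (maxL ys))

maxL-least : ∀ {k} xs → (∀ {x} → x ∈ xs → x ≤ k) → maxL xs ≤ k
maxL-least [] _ = ℕ.z≤n
maxL-least (y ∷ ys) ub = ℕ.⊔-lub (ub (here refl)) (maxL-least ys (λ x∈ys → ub (there x∈ys)))

lvlEv≤⇒lvlE≤ : ∀ {n} (ℓ : Levels n) v e → lvlEv ℓ v e ≤ ℓ v → lvlE ℓ e ≤ ℓ v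
lvlEv≤⇒lvlE≤ {n} ℓ v e lvlEv≤ = maxL-least _ λ x∈ → case ∈-map⁻ ℓ x∈ of λ where
    (u , u∈e , refl) → member≤ u∈e
  where
  member≤ : ∀ {u} → u ∈ filter (_∈? e) (allFin n) → ℓ u ≤ ℓ v
  member≤ {u} u∈e with u ≟ᶠ v
  ... | yes refl = ℕ.≤-refl
  ... | no  u≢v  = ℕ.≤-trans (maxL-upper _ (∈-map⁺ ℓ u∈e∖v)) lvlEv≤
    where
    u∈e∖v = ∈-filter⁺ (_∈? e) (∈-filter⁺ (λ u → ¬? (u ≟ᶠ v)) (∈-allFin u) u≢v)
                      (proj₂ (∈-filter⁻ (_∈? e) {xs = allFin n} u∈e))

countLe-×-β⁻≤W : ∀ {n} (E : List (Edge n)) ℓ v →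
                 countLe E ℓ v (ℓ v) × β⁻ (ℓ v) ℚ.≤ W E ℓ v
countLe-×-β⁻≤W E ℓ v =
  length-filter-×≤sum (λ e → lvlEv ℓ v e ℕ.≤? ℓ v) (λ e → β⁻ (lvlE ℓ e)) (β⁻ (ℓ v))
    (λ e → β⁻-nonNeg (lvlE ℓ e))
    (λ e lvlEv≤ → β⁻-antimono-≤ (lvlEv≤⇒lvlE≤ ℓ v e lvlEv≤))
    (incident E v)

down-jump-cost≤incI : ∀ {n} f (E : List (Edge n)) ℓ v → DownDirty f E ℓ v →
                      (+ countLe E ℓ v (ℓ v)) / 1 ℚ.≤ incI f (ℓ v)
down-jump-cost≤incI f E ℓ v (_ , W≤) =
  ×-1/≤1/⇒≤/ (countLe E ℓ v (ℓ v)) (β ℕ.^ ℓ v) (α f ℕ.* (β ℕ.* β))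
    {{ℕ.m^n≢0 β (ℓ v)}} {{ℕ.>-nonZero (ℕ.s≤s ℕ.z≤n)}}
    (ℚ.≤-trans (countLe-×-β⁻≤W E ℓ v) W≤)

Cdown≤Idown : ∀ {n f L} {s : State n} → Reachable f L s → (+ Cdown s) / 1 ℚ.≤ Idown s
Cdown≤Idown init = ℚ.≤-refl
Cdown≤Idown (insert _ r _ _ _) = Cdown≤Idown r
Cdown≤Idown (delete _ r _) = Cdown≤Idown r
Cdown≤Idown (up-jump _ _ r _ _ _ _ _) = Cdown≤Idown r
Cdown≤Idown {f = f} (down-jump {E} {ℓ} {cd = cd} v _ r _ dirty _) =
  subst (ℚ._≤ _) (+-/ (+ cd) (+ countLe E ℓ v (ℓ v)) 0)
    (ℚ.+-mono-≤ (Cdown≤Idown r) (down-jump-cost≤incI f E ℓ v dirty))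

-- The bound is local to each down-jump, so neither n ≥ 1 nor the value of L is needed.
lemma4 : (n f L : ℕ) → 1 ≤ n → IsL n f L →
    (s : State n) → Reachable f L s →
    (+ Cdown s) / 1 ℚ.≤ Idown s
lemma4 _ _ _ _ _ _ = Cdown≤Idown
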